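{- Let $f:\mathbb{F}_2^{2m}\to\mathbb{F}_2$ be bent. For all $b,c\in\mathbb{F}_2^{2m}$, $$\mathrm{wc}\big(x\mapsto f(x+b)+\langle c,x\rangle+f(b)\big)=f(b)+\langle c,b\rangle+\tilde f(c).$$ That is, the weight class matrix $M_{wc}(f)$ equals the matrix $M_D(f)$ given by $M_D(f)_{c,b}=f(b)+\langle c,b\rangle+\tilde f(c)$ (the incidence matrix of the SDP design of $f$).
   Context: $\langle x,y\rangle=\sum_ix_iy_i$ over $\mathbb{F}_2$. $W_f(x)=\sum_y(-1)^{f(y)+\langle x,y\rangle}$; $f$ is bent iff $|W_f|\equiv 2^m$; the dual $\tilde f$ is given by $(-1)^{\tilde f(x)}=2^{ -m}W_f(x)$. A bent function $g$ on $\mathbb{F}_2^{2m}$ has weight class number $\mathrm{wc}(g)=0$ if $|\{x:g(x)=1\}|=2^{2m-1}-2^{m-1}$ and $\mathrm{wc}(g)=1$ if it equals $2^{2m-1}+2^{m-1}$. The weight class matrix is $M_{wc}(f)_{c,b}:=\mathrm{wc}(x\mapsto f(x+b)+\langle c,x\rangle+f(b))$, indexed by $c,b\in\mathbb{F}_2^{2m}$. -}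

module Defs where

open import Data.Bool using (Bool; true; false; _xor_; _∧_; if_then_else_)
open import Data.Nat as ℕ using (ℕ; zero; suc; _^_)
open import Data.Integer as ℤ using (ℤ; +_; -_)
open import Data.List using (List; []; _∷_; _++_; map; foldr)
open import Data.Nat.ListAction using (sum)
open import Data.Vec using (Vec; []; _∷_; zipWith)
open import Relation.Binary.PropositionalEquality using (_≡_)

-- 𝔽₂ is modelled by Bool (false = 0, true = 1, _xor_ = addition, _∧_ = multiplication).
-- 𝔽₂ⁿ is Vec Bool n.
V : ℕ → Set
V n = Vec Bool n

_⊕_ : ∀ {n} → V n → V n → V n
x ⊕ y = zipWith _xor_ x y

⟨_,_⟩ : ∀ {n} → V n → V n → Bool
⟨ x , y ⟩ = foldr _xor_ false (Data.Vec.toList (zipWith _∧_ x y))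

allVecs : (n : ℕ) → List (V n)
allVecs zero = [] ∷ []
allVecs (suc n) = map (false ∷_) (allVecs n) ++ map (true ∷_) (allVecs n)

sgn : Bool → ℤ
sgn false = + 1
sgn true = - (+ 1)

sumℤ : List ℤ → ℤ
sumℤ = foldr ℤ._+_ (+ 0)

W : ∀ {n} → (V n → Bool) → V n → ℤ
W {n} f x = sumℤ (map (λ y → sgn (f y xor ⟨ x , y ⟩)) (allVecs n))

IsBent : (m : ℕ) → (V (2 ℕ.* m) → Bool) → Set
IsBent m f = ∀ x → ℤ.∣ W f x ∣ ≡ 2 ^ m

-- fd is the dual of f: (-1)^{fd(x)} = 2^{-m} W_f(x), i.e. W_f(x) = (-1)^{fd(x)} 2^m
IsDual : (m : ℕ) → (V (2 ℕ.* m) → Bool) → (V (2 ℕ.* m) → Bool) → Set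
IsDual m f fd = ∀ x → W f x ≡ sgn (fd x) ℤ.* (+ (2 ^ m))

weight : ∀ {n} → (V n → Bool) → ℕ
weight {n} g = sum (map (λ x → if g x then 1 else 0) (allVecs n))

-- wc(g) ≡ v, for g on 𝔽₂^{2m}:
--   v = 0 (false): weight = 2^{2m-1} - 2^{m-1}, i.e. 2·weight + 2^m = 2^{2m}
--   v = 1 (true) : weight = 2^{2m-1} + 2^{m-1}, i.e. 2·weight = 2^{2m} + 2^m
WC : (m : ℕ) → (V (2 ℕ.* m) → Bool) → Bool → Set
WC m g false = 2 ℕ.* weight g ℕ.+ 2 ^ m ≡ 2 ^ (2 ℕ.* m)
WC m g true = 2 ℕ.* weight g ≡ 2 ^ (2 ℕ.* m) ℕ.+ 2 ^ m

-- Translating f by b and adding the linear function ⟨c,·⟩ turns the sign sum of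
-- g(x) = f(x+b) + ⟨c,x⟩ + f(b) into (-1)^{f(b)+⟨c,b⟩} W_f(c) = (-1)^{f(b)+⟨c,b⟩+f̃(c)} 2^m.
-- The weight of any Boolean function g on 𝔽₂ⁿ is read off its sign sum through
-- Σ_x (-1)^{g(x)} + 2 wt(g) = 2ⁿ, which gives the two weight classes 2^{2m-1} ∓ 2^{m-1}.
module Submission where

open import Defs
open import Data.Nat using (ℕ; _*_)
open import Data.Bool using (Bool; _xor_)

open import Algebra.Bundles using (CommutativeRing)
import Algebra.Properties.CommutativeSemigroup as CommSemigroupProperties
open import Data.Bool using (true; false; _∧_; if_then_else_)
open import Data.Bool.Properties using (xor-∧-commutativeRing; ∧-distribˡ-xor; xor-assoc)
open import Data.Integer as ℤ using (ℤ; +_; -_)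
import Data.Integer.Properties as ℤ
open import Data.Integer.Tactic.RingSolver using (solve-∀)
open import Data.List using (List; []; _∷_; _++_; map; length)
open import Data.List.Properties using (map-++; map-cong; map-∘; length-++; length-map)
import Data.Nat as ℕ
import Data.Nat.Properties as ℕ
open import Data.Nat.ListAction using (sum)
open import Data.Vec using ([]; _∷_)
open import Function using (_∘_)
open import Relation.Binary.PropositionalEquality
open ≡-Reasoning

open CommSemigroupProperties ℤ.+-commutativeSemigroup using () renaming (interchange to +-interchange)
open CommSemigroupProperties (CommutativeRing.+-commutativeSemigroup xor-∧-commutativeRing)
  using () renaming (interchange to xor-interchange)

⟨,⟩-linearʳ : ∀ {n} (c y b : V n) → ⟨ c , y ⊕ b ⟩ ≡ ⟨ c , y ⟩ xor ⟨ c , b ⟩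
⟨,⟩-linearʳ [] [] [] = refl
⟨,⟩-linearʳ (c ∷ cs) (y ∷ ys) (b ∷ bs) = begin
  (c ∧ (y xor b)) xor ⟨ cs , ys ⊕ bs ⟩
    ≡⟨ cong₂ _xor_ (∧-distribˡ-xor c y b) (⟨,⟩-linearʳ cs ys bs) ⟩
  ((c ∧ y) xor (c ∧ b)) xor (⟨ cs , ys ⟩ xor ⟨ cs , bs ⟩)
    ≡⟨ xor-interchange (c ∧ y) (c ∧ b) ⟨ cs , ys ⟩ ⟨ cs , bs ⟩ ⟩
  ((c ∧ y) xor ⟨ cs , ys ⟩) xor ((c ∧ b) xor ⟨ cs , bs ⟩) ∎

sgn-xor : ∀ x y → sgn (x xor y) ≡ sgn x ℤ.* sgn y
sgn-xor false false = refl
sgn-xor false true = refl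
sgn-xor true false = refl
sgn-xor true true = refl

sgn-square : ∀ x → sgn x ℤ.* sgn x ≡ + 1
sgn-square false = refl
sgn-square true = refl

sumℤ-++ : ∀ (xs ys : List ℤ) → sumℤ (xs ++ ys) ≡ sumℤ xs ℤ.+ sumℤ ys
sumℤ-++ [] ys = sym (ℤ.+-identityˡ _)
sumℤ-++ (x ∷ xs) ys = trans (cong (ℤ._+_ x) (sumℤ-++ xs ys)) (sym (ℤ.+-assoc x _ _))

sumℤ-map-*ˡ : ∀ {A : Set} (k : ℤ) (h : A → ℤ) (xs : List A) →
              sumℤ (map (λ x → k ℤ.* h x) xs) ≡ k ℤ.* sumℤ (map h xs)
sumℤ-map-*ˡ k h [] = sym (ℤ.*-zeroʳ k)
sumℤ-map-*ˡ k h (x ∷ xs) =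
  trans (cong (ℤ._+_ (k ℤ.* h x)) (sumℤ-map-*ˡ k h xs)) (sym (ℤ.*-distribˡ-+ k (h x) _))

length-allVecs : ∀ n → length (allVecs n) ≡ 2 ℕ.^ n
length-allVecs ℕ.zero = refl
length-allVecs (ℕ.suc n) = begin
  length (map (false ∷_) (allVecs n) ++ map (true ∷_) (allVecs n))
    ≡⟨ length-++ (map (false ∷_) (allVecs n)) ⟩
  length (map (false ∷_) (allVecs n)) ℕ.+ length (map (true ∷_) (allVecs n))
    ≡⟨ cong₂ ℕ._+_ (length-map (false ∷_) (allVecs n)) (length-map (true ∷_) (allVecs n)) ⟩
  length (allVecs n) ℕ.+ length (allVecs n)
    ≡⟨ cong (λ k → k ℕ.+ k) (length-allVecs n) ⟩
  2 ℕ.^ n ℕ.+ 2 ℕ.^ n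
    ≡⟨ cong (2 ℕ.^ n ℕ.+_) (sym (ℕ.+-identityʳ (2 ℕ.^ n))) ⟩
  2 ℕ.^ ℕ.suc n ∎

∑ : (n : ℕ) → (V n → ℤ) → ℤ
∑ n h = sumℤ (map h (allVecs n))

∑-cong : ∀ n {h k : V n → ℤ} → (∀ x → h x ≡ k x) → ∑ n h ≡ ∑ n k
∑-cong n eq = cong sumℤ (map-cong eq (allVecs n))

∑-*ˡ : ∀ n (k : ℤ) (h : V n → ℤ) → ∑ n (λ x → k ℤ.* h x) ≡ k ℤ.* ∑ n h
∑-*ˡ n k h = sumℤ-map-*ˡ k h (allVecs n)

∑-suc : ∀ n (h : V (ℕ.suc n) → ℤ) → ∑ (ℕ.suc n) h ≡ ∑ n (h ∘ (false ∷_)) ℤ.+ ∑ n (h ∘ (true ∷_))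
∑-suc n h = begin
  sumℤ (map h (map (false ∷_) (allVecs n) ++ map (true ∷_) (allVecs n)))
    ≡⟨ cong sumℤ (map-++ h (map (false ∷_) (allVecs n)) _) ⟩
  sumℤ (map h (map (false ∷_) (allVecs n)) ++ map h (map (true ∷_) (allVecs n)))
    ≡⟨ sumℤ-++ (map h (map (false ∷_) (allVecs n))) _ ⟩
  sumℤ (map h (map (false ∷_) (allVecs n))) ℤ.+ sumℤ (map h (map (true ∷_) (allVecs n)))
    ≡⟨ sym (cong₂ ℤ._+_ (cong sumℤ (map-∘ (allVecs n))) (cong sumℤ (map-∘ (allVecs n)))) ⟩
  ∑ n (h ∘ (false ∷_)) ℤ.+ ∑ n (h ∘ (true ∷_)) ∎

∑-translate : ∀ n (b : V n) (h : V n → ℤ) → ∑ n (λ x → h (x ⊕ b)) ≡ ∑ n h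
∑-translate ℕ.zero [] h = refl
∑-translate (ℕ.suc n) (false ∷ b) h = begin
  ∑ (ℕ.suc n) (λ x → h (x ⊕ (false ∷ b)))
    ≡⟨ ∑-suc n _ ⟩
  ∑ n (λ x → h (false ∷ x ⊕ b)) ℤ.+ ∑ n (λ x → h (true ∷ x ⊕ b))
    ≡⟨ cong₂ ℤ._+_ (∑-translate n b (h ∘ (false ∷_))) (∑-translate n b (h ∘ (true ∷_))) ⟩
  ∑ n (h ∘ (false ∷_)) ℤ.+ ∑ n (h ∘ (true ∷_))
    ≡⟨ sym (∑-suc n h) ⟩
  ∑ (ℕ.suc n) h ∎
∑-translate (ℕ.suc n) (true ∷ b) h = begin
  ∑ (ℕ.suc n) (λ x → h (x ⊕ (true ∷ b)))
    ≡⟨ ∑-suc n _ ⟩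
  ∑ n (λ x → h (true ∷ x ⊕ b)) ℤ.+ ∑ n (λ x → h (false ∷ x ⊕ b))
    ≡⟨ cong₂ ℤ._+_ (∑-translate n b (h ∘ (true ∷_))) (∑-translate n b (h ∘ (false ∷_))) ⟩
  ∑ n (h ∘ (true ∷_)) ℤ.+ ∑ n (h ∘ (false ∷_))
    ≡⟨ ℤ.+-comm (∑ n (h ∘ (true ∷_))) _ ⟩
  ∑ n (h ∘ (false ∷_)) ℤ.+ ∑ n (h ∘ (true ∷_))
    ≡⟨ sym (∑-suc n h) ⟩
  ∑ (ℕ.suc n) h ∎

signSum+2*weight≡length : ∀ {A : Set} (g : A → Bool) (xs : List A) →
  sumℤ (map (sgn ∘ g) xs) ℤ.+ + (2 ℕ.* sum (map (λ x → if g x then 1 else 0) xs)) ≡ + length xs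
signSum+2*weight≡length g [] = refl
signSum+2*weight≡length g (x ∷ xs) = begin
  (sgn (g x) ℤ.+ s) ℤ.+ + (2 ℕ.* (i ℕ.+ w))
    ≡⟨ cong (ℤ._+_ (sgn (g x) ℤ.+ s)) (trans (cong +_ (ℕ.*-distribˡ-+ 2 i w)) (ℤ.pos-+ (2 ℕ.* i) _)) ⟩
  (sgn (g x) ℤ.+ s) ℤ.+ (+ (2 ℕ.* i) ℤ.+ + (2 ℕ.* w))
    ≡⟨ +-interchange (sgn (g x)) s (+ (2 ℕ.* i)) _ ⟩
  (sgn (g x) ℤ.+ + (2 ℕ.* i)) ℤ.+ (s ℤ.+ + (2 ℕ.* w))
    ≡⟨ cong₂ ℤ._+_ (sgn+2*indicator (g x)) (signSum+2*weight≡length g xs) ⟩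
  + ℕ.suc (length xs) ∎
  where
  s = sumℤ (map (sgn ∘ g) xs)
  i = if g x then 1 else 0
  w = sum (map (λ x → if g x then 1 else 0) xs)
  sgn+2*indicator : ∀ y → sgn y ℤ.+ + (2 ℕ.* (if y then 1 else 0)) ≡ + 1
  sgn+2*indicator false = refl
  sgn+2*indicator true = refl

signSum+2*weight : ∀ {n} (g : V n → Bool) → ∑ n (sgn ∘ g) ℤ.+ + (2 ℕ.* weight g) ≡ + 2 ℕ.^ n
signSum+2*weight {n} g = trans (signSum+2*weight≡length g (allVecs n)) (cong +_ (length-allVecs n))

WC-from-signSum : ∀ m (g : V (2 * m) → Bool) v → ∑ (2 * m) (sgn ∘ g) ≡ sgn v ℤ.* + 2 ℕ.^ m → WC m g v
WC-from-signSum m g v signSum≡ = weightClass v (subst (λ t → t ℤ.+ + (2 ℕ.* weight g) ≡ + 2 ℕ.^ (2 * m))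
                                                      signSum≡ (signSum+2*weight g))
  where
  b≡[-a+b]+a : ∀ a b → b ≡ (- a ℤ.+ b) ℤ.+ a
  b≡[-a+b]+a = solve-∀

  weightClass : ∀ v → sgn v ℤ.* + 2 ℕ.^ m ℤ.+ + (2 ℕ.* weight g) ≡ + 2 ℕ.^ (2 * m) → WC m g v
  weightClass false balance = trans (ℕ.+-comm (2 ℕ.* weight g) _) (ℤ.+-injective (begin
    + (2 ℕ.^ m ℕ.+ 2 ℕ.* weight g)
      ≡⟨ ℤ.pos-+ (2 ℕ.^ m) _ ⟩
    + 2 ℕ.^ m ℤ.+ + (2 ℕ.* weight g)
      ≡⟨ cong (λ t → t ℤ.+ + (2 ℕ.* weight g)) (sym (ℤ.*-identityˡ (+ 2 ℕ.^ m))) ⟩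
    sgn false ℤ.* + 2 ℕ.^ m ℤ.+ + (2 ℕ.* weight g)
      ≡⟨ balance ⟩
    + 2 ℕ.^ (2 * m) ∎))
  weightClass true balance = ℤ.+-injective (begin
    + (2 ℕ.* weight g)
      ≡⟨ b≡[-a+b]+a (+ 2 ℕ.^ m) (+ (2 ℕ.* weight g)) ⟩
    (- (+ 2 ℕ.^ m) ℤ.+ + (2 ℕ.* weight g)) ℤ.+ + 2 ℕ.^ m
      ≡⟨ cong (λ t → (t ℤ.+ + (2 ℕ.* weight g)) ℤ.+ + 2 ℕ.^ m) (sym (ℤ.-1*i≡-i (+ 2 ℕ.^ m))) ⟩
    (sgn true ℤ.* + 2 ℕ.^ m ℤ.+ + (2 ℕ.* weight g)) ℤ.+ + 2 ℕ.^ m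
      ≡⟨ cong (ℤ._+ + 2 ℕ.^ m) balance ⟩
    + 2 ℕ.^ (2 * m) ℤ.+ + 2 ℕ.^ m
      ≡⟨ sym (ℤ.pos-+ (2 ℕ.^ (2 * m)) _) ⟩
    + (2 ℕ.^ (2 * m) ℕ.+ 2 ℕ.^ m) ∎)

signSum-translate-modulate : ∀ {n} (f : V n → Bool) (b c : V n) →
  ∑ n (λ x → sgn (f (x ⊕ b) xor ⟨ c , x ⟩ xor f b)) ≡ sgn (f b xor ⟨ c , b ⟩) ℤ.* W f c
signSum-translate-modulate {n} f b c = begin
  ∑ n (λ x → sgn (f (x ⊕ b) xor ⟨ c , x ⟩ xor f b))
    ≡⟨ ∑-cong n summand ⟩
  ∑ n (λ x → k ℤ.* character (x ⊕ b))
    ≡⟨ ∑-*ˡ n k (character ∘ (_⊕ b)) ⟩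
  k ℤ.* ∑ n (character ∘ (_⊕ b))
    ≡⟨ cong (k ℤ.*_) (∑-translate n b character) ⟩
  k ℤ.* W f c ∎
  where
  k = sgn (f b xor ⟨ c , b ⟩)
  character : V n → ℤ
  character y = sgn (f y xor ⟨ c , y ⟩)

  sgn-xor³ : ∀ x y z → sgn (x xor y xor z) ≡ sgn x ℤ.* (sgn y ℤ.* sgn z)
  sgn-xor³ x y z = trans (sgn-xor x (y xor z)) (cong (sgn x ℤ.*_) (sgn-xor y z))

  -- the factor (-1)^{⟨c,b⟩} introduced by k cancels since it squares to 1
  reassociate : ∀ F P B Q → (B ℤ.* Q) ℤ.* (F ℤ.* (P ℤ.* Q)) ≡ (F ℤ.* (P ℤ.* B)) ℤ.* (Q ℤ.* Q)
  reassociate = solve-∀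

  summand : ∀ x → sgn (f (x ⊕ b) xor ⟨ c , x ⟩ xor f b) ≡ k ℤ.* character (x ⊕ b)
  summand x = begin
    sgn (F xor P xor B)                         ≡⟨ sgn-xor³ F P B ⟩
    sgn F ℤ.* (sgn P ℤ.* sgn B)                 ≡⟨ sym (ℤ.*-identityʳ _) ⟩
    sgn F ℤ.* (sgn P ℤ.* sgn B) ℤ.* + 1         ≡⟨ cong (sgn F ℤ.* (sgn P ℤ.* sgn B) ℤ.*_) (sym (sgn-square Q)) ⟩
    sgn F ℤ.* (sgn P ℤ.* sgn B) ℤ.* (sgn Q ℤ.* sgn Q)
                                                ≡⟨ sym (reassociate (sgn F) (sgn P) (sgn B) (sgn Q)) ⟩
    (sgn B ℤ.* sgn Q) ℤ.* (sgn F ℤ.* (sgn P ℤ.* sgn Q))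
                                                ≡⟨ sym (cong₂ ℤ._*_ (sgn-xor B Q) (sgn-xor³ F P Q)) ⟩
    k ℤ.* sgn (F xor P xor Q)                   ≡⟨ cong (λ t → k ℤ.* sgn (F xor t)) (sym (⟨,⟩-linearʳ c x b)) ⟩
    k ℤ.* character (x ⊕ b) ∎
    where
    F = f (x ⊕ b)
    P = ⟨ c , x ⟩
    B = f b
    Q = ⟨ c , b ⟩

mainTheorem8 : (m : ℕ) (f fd : V (2 * m) → Bool) → IsBent m f → IsDual m f fd →
    (b c : V (2 * m)) →
      WC m (λ x → f (x ⊕ b) xor ⟨ c , x ⟩ xor f b) (f b xor ⟨ c , b ⟩ xor fd c)
mainTheorem8 m f fd _ dual b c = WC-from-signSum m _ _ (begin
  ∑ (2 * m) (λ x → sgn (f (x ⊕ b) xor ⟨ c , x ⟩ xor f b))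
    ≡⟨ signSum-translate-modulate f b c ⟩
  sgn (f b xor ⟨ c , b ⟩) ℤ.* W f c
    ≡⟨ cong (sgn (f b xor ⟨ c , b ⟩) ℤ.*_) (dual c) ⟩
  sgn (f b xor ⟨ c , b ⟩) ℤ.* (sgn (fd c) ℤ.* + 2 ℕ.^ m)
    ≡⟨ sym (ℤ.*-assoc (sgn (f b xor ⟨ c , b ⟩)) _ _) ⟩
  sgn (f b xor ⟨ c , b ⟩) ℤ.* sgn (fd c) ℤ.* + 2 ℕ.^ m
    ≡⟨ cong (ℤ._* + 2 ℕ.^ m) (sym (sgn-xor (f b xor ⟨ c , b ⟩) (fd c))) ⟩
  sgn ((f b xor ⟨ c , b ⟩) xor fd c) ℤ.* + 2 ℕ.^ m
    ≡⟨ cong (λ t → sgn t ℤ.* + 2 ℕ.^ m) (xor-assoc (f b) ⟨ c , b ⟩ (fd c)) ⟩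
  sgn (f b xor ⟨ c , b ⟩ xor fd c) ℤ.* + 2 ℕ.^ m ∎)
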